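{- Let $F$ be a bipartite graph with a vertex $v$ such that $F-v$ is a forest. There exists a constant $c=c(F)$ such that for any graph $G$ whose vertex set is partitioned as $V(G)=U\sqcup W$ with $$2e(U)+e(U,W)>3c|U|+c|W|,$$ there is a copy of $F-v$ in $G$ in which the neighborhood $N_F(v)$ is embedded in $U$.
   Context: $e(U)$ is the number of edges of $G$ with both endpoints in $U$, and $e(U,W)$ is the number of edges with one endpoint in $U$ and the other in $W$. -}

module Defs where

open import Data.Nat using (ℕ; zero; suc; _+_; _*_; _<_; _<ᵇ_)
open import Data.Bool using (Bool; true; false; _∧_; not; if_then_else_)
open import Data.Fin using (Fin; toℕ; inject₁; fromℕ) renaming (zero to fzero; suc to fsuc)
open import Data.List using (List; map; allFin)
open import Data.Nat.ListAction using (sum)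
open import Data.Product using (Σ; _×_; _,_)
open import Relation.Binary.PropositionalEquality using (_≡_; _≢_)
open import Relation.Nullary using (¬_)

record Graph (n : ℕ) : Set where
  field
    adj    : Fin n → Fin n → Bool
    symm   : ∀ i j → adj i j ≡ adj j i
    irrefl : ∀ i → adj i i ≡ false
open Graph public

Adj : ∀ {n} → Graph n → Fin n → Fin n → Set
Adj G x y = adj G x y ≡ true

[_] : Bool → ℕ
[ true ] = 1
[ false ] = 0

Σ-Fin : (n : ℕ) → (Fin n → ℕ) → ℕ
Σ-Fin n f = sum (map f (allFin n))

-- A vertex subset U ⊆ V(G) given by its indicator; W is its complement,
-- so V(G) = U ⊔ W.
VSet : ℕ → Set
VSet n = Fin n → Bool

card : ∀ {n} → VSet n → ℕ
card {n} U = Σ-Fin n (λ i → [ U i ])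

compl : ∀ {n} → VSet n → VSet n
compl U i = not (U i)

-- e(U): number of edges with both endpoints in U (each unordered edge {i,j}
-- counted once, via toℕ i < toℕ j)
e : ∀ {n} → Graph n → VSet n → ℕ
e {n} G U = Σ-Fin n (λ i → Σ-Fin n (λ j →
  [ (toℕ i <ᵇ toℕ j) ∧ adj G i j ∧ U i ∧ U j ]))

-- e(U,W): number of edges with one endpoint in U and the other in W
-- (for disjoint U, W each such edge is counted once)
e₂ : ∀ {n} → Graph n → VSet n → VSet n → ℕ
e₂ {n} G U W = Σ-Fin n (λ i → Σ-Fin n (λ j → [ adj G i j ∧ U i ∧ W j ]))

Bipartite : ∀ {m} → Graph m → Set
Bipartite {m} F = Σ (Fin m → Bool) λ col →
  ∀ x y → Adj F x y → col x ≢ col y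

-- A cycle in F avoiding vertex v: distinct vertices c₀,…,c_{l+2} (length ≥ 3),
-- none equal to v, with c_i ~ c_{i+1} and c_{l+2} ~ c₀.
CycleAvoiding : ∀ {m} → Graph m → Fin m → Set
CycleAvoiding {m} F v = Σ ℕ λ l → Σ (Fin (suc (suc (suc l))) → Fin m) λ c →
    (∀ i j → c i ≡ c j → i ≡ j)
  × (∀ i → c i ≢ v)
  × (∀ (i : Fin (suc (suc l))) → Adj F (c (inject₁ i)) (c (fsuc i)))
  × Adj F (c (fromℕ (suc (suc l)))) (c fzero)

DeleteIsForest : ∀ {m} → Graph m → Fin m → Set
DeleteIsForest F v = ¬ CycleAvoiding F v

CopyMinusWithNbhdIn : ∀ {m n} → Graph m → Fin m → Graph n → VSet n → Set
CopyMinusWithNbhdIn {m} {n} F v G U =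
  Σ ((x : Fin m) → x ≢ v → Fin n) λ φ →
      (∀ x y (px : x ≢ v) (py : y ≢ v) → φ x px ≡ φ y py → x ≡ y)
    × (∀ x y (px : x ≢ v) (py : y ≢ v) → Adj F x y → Adj G (φ x px) (φ y py))
    × (∀ x (px : x ≢ v) → Adj F v x → U (φ x px) ≡ true)

{-# OPTIONS --safe #-}
-- Let c be the number of vertices of F − v. The hypothesis forces e(U) > c|U| or e(U,W) > c|V(G)|.
-- Deleting a vertex of degree at most c destroys at most 2c ordered adjacent pairs, so repeated
-- deletion leaves a nonempty subgraph of minimum degree > c: of G[U] in the first case, of the
-- bipartite graph of U–W edges in the second. A forest has a leaf order (otherwise some set of its
-- vertices, each with two neighbours in the set, would carry a non-backtracking walk and hence a
-- cycle), and F − v embeds greedily along it: each new vertex has at most one embedded neighbour,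
-- whose image has more than c neighbours in the subgraph, fewer than c of them used. In the
-- bipartite case the colour class of F not containing v goes to U, so N_F(v) lands in U.
module Submission where

open import Defs
open import Data.Nat using (ℕ; _+_; _*_; _>_)
open import Data.Fin using (Fin)
open import Data.Product using (Σ)

open import Data.Bool using (Bool; true; false; not; _∧_; _xor_; T)
import Data.Bool.Properties as Bool
open import Data.Bool.Properties
  using (∧-conicalˡ; ∧-conicalʳ; ∧-zeroʳ; ∧-identityʳ; ∧-comm; xor-comm; xor-same;
         not-distribˡ-xor; ¬-not; not-involutive)
open import Data.Fin using (zero; suc; toℕ; fromℕ<; fromℕ; inject₁)
open import Data.Fin.Properties
  using (_≟_; any?; all?; ¬∀⟶∃¬; pigeonhole; punchInᵢ≢i; toℕ<n; toℕ-injective; toℕ-fromℕ<;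
         toℕ-inject₁; toℕ-fromℕ)
open import Data.List using (List; []; _∷_; length; map; tabulate)
open import Data.List.Membership.Propositional using (_∈_; _∉_; find; lose)
open import Data.List.Membership.Propositional.Properties using (∈-map⁺)
open import Data.List.Properties using (map-tabulate; length-map)
import Data.List.Relation.Unary.Any as Any
open import Data.List.Relation.Unary.Any using (here; there)
open import Data.Nat using (zero; suc; _≤_; _<_; _<ᵇ_; z≤n; z<s; s≤s⁻¹; s<s⁻¹; _≤?_; _<?_)
open import Data.Nat.GeneralisedArithmetic using (fold)
import Data.Nat.ListAction as ListAction
open import Data.Nat.Properties hiding (_≟_)
open import Algebra.Properties.CommutativeMonoid.Sum +-0-commutativeMonoid
  using (sum; sum-cong-≗; sum-remove; sum-replicate-zero; ∑-distrib-+; ∑-comm)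
open import Data.Nat.Tactic.RingSolver using (solve-∀)
open import Data.Product using (∃; _×_; _,_; proj₁; proj₂)
open import Data.Sum using (_⊎_; inj₁; inj₂)
open import Data.Vec.Functional using (removeAt; updateAt)
open import Data.Vec.Functional.Properties using (updateAt-updates; updateAt-minimal)
open import Function using (_∘_; id; const)
open import Relation.Binary.Definitions using (DecidableEquality)
open import Relation.Binary.PropositionalEquality
  using (_≡_; _≢_; refl; sym; trans; cong; cong₂; subst; module ≡-Reasoning)
open import Relation.Nullary using (¬_; Dec; yes; no; does; contradiction; ¬?)
open import Relation.Nullary.Decidable using (dec-true; dec-false; _×-dec_; decidable-stable)

private
  variable
    n : ℕ

sum-tabulate : (f : Fin n → ℕ) → ListAction.sum (tabulate f) ≡ sum f
sum-tabulate {zero}  f = refl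
sum-tabulate {suc n} f = cong (f zero +_) (sum-tabulate (f ∘ suc))

Σ-Fin≡sum : (f : Fin n → ℕ) → Σ-Fin n f ≡ sum f
Σ-Fin≡sum f = trans (cong ListAction.sum (map-tabulate id f)) (sum-tabulate f)

sum-mono-≤ : {f g : Fin n → ℕ} → (∀ i → f i ≤ g i) → sum f ≤ sum g
sum-mono-≤ {zero}  f≤g = z≤n
sum-mono-≤ {suc n} f≤g = +-mono-≤ (f≤g zero) (sum-mono-≤ (f≤g ∘ suc))

sum-supported-at : ∀ {f : Fin n → ℕ} i → (∀ j → j ≢ i → f j ≡ 0) → sum f ≡ f i
sum-supported-at {suc n} {f} i f≡0 = begin
  sum f                    ≡⟨ sum-remove {i = i} f ⟩
  f i + sum (removeAt f i) ≡⟨ cong (f i +_) (sum-cong-≗ λ j → f≡0 _ (punchInᵢ≢i i j)) ⟩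
  f i + sum {n} (λ _ → 0)  ≡⟨ cong (f i +_) (sum-replicate-zero n) ⟩
  f i + 0                  ≡⟨ +-identityʳ (f i) ⟩
  f i                      ∎
  where open ≡-Reasoning

sum-positive : (f : Fin n → ℕ) → 0 < sum f → ∃ λ i → 0 < f i
sum-positive {suc n} f 0<Σf with f zero in f₀≡
... | suc _ = zero , subst (0 <_) (sym f₀≡) z<s
... | zero  with sum-positive (f ∘ suc) 0<Σf
...   | i , 0<fi = suc i , 0<fi

sum² : (Fin n → Fin n → ℕ) → ℕ
sum² f = sum λ i → sum (f i)

Σ-Fin²≡sum² : (f : Fin n → Fin n → ℕ) → Σ-Fin n (λ i → Σ-Fin n (f i)) ≡ sum² f
Σ-Fin²≡sum² {n} f = trans (Σ-Fin≡sum λ i → Σ-Fin n (f i)) (sum-cong-≗ {n} λ i → Σ-Fin≡sum (f i))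

sum²-mono-≤ : {f g : Fin n → Fin n → ℕ} → (∀ i j → f i j ≤ g i j) → sum² f ≤ sum² g
sum²-mono-≤ {n} f≤g = sum-mono-≤ {n} λ i → sum-mono-≤ {n} (f≤g i)

sum²-distrib-+ : (f g : Fin n → Fin n → ℕ) → sum² (λ i j → f i j + g i j) ≡ sum² f + sum² g
sum²-distrib-+ {n} f g =
  trans (sum-cong-≗ {n} λ i → ∑-distrib-+ (f i) (g i)) (∑-distrib-+ {n} (sum ∘ f) (sum ∘ g))

sum²-double : (f g : Fin n → Fin n → ℕ) → (∀ i j → f i j + f j i ≤ g i j) → 2 * sum² f ≤ sum² g
sum²-double {n} f g f+fᵀ≤g = begin
  2 * sum² f                    ≡⟨ cong (sum² f +_) (+-identityʳ (sum² f)) ⟩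
  sum² f + sum² f               ≡⟨ cong (sum² f +_) (∑-comm {n} {n} f) ⟩
  sum² f + sum² (λ i j → f j i) ≡⟨ sum²-distrib-+ f (λ i j → f j i) ⟨
  sum² (λ i j → f i j + f j i)  ≤⟨ sum²-mono-≤ f+fᵀ≤g ⟩
  sum² g                        ∎
  where open ≤-Reasoning

∧-intro : ∀ {x y} → x ≡ true → y ≡ true → x ∧ y ≡ true
∧-intro refl refl = refl

[]-mono : ∀ {x y} → (x ≡ true → y ≡ true) → [ x ] ≤ [ y ]
[]-mono {false} _   = z≤n
[]-mono {true}  x⇒y rewrite x⇒y refl = ≤-refl

[]-positive : ∀ {x} → 0 < [ x ] → x ≡ true
[]-positive {true} _ = refl

[]≤1 : ∀ x → [ x ] ≤ 1
[]≤1 true  = ≤-refl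
[]≤1 false = z≤n

irrefl-Adj : (G : Graph n) {i : Fin n} → ¬ Adj G i i
irrefl-Adj G {i} Gii = contradiction (trans (sym (irrefl G i)) Gii) λ ()

sym-Adj : (G : Graph n) {i j : Fin n} → Adj G i j → Adj G j i
sym-Adj G {i} {j} Gij = trans (symm G j i) Gij

_⊆_ : VSet n → VSet n → Set
P ⊆ Q = ∀ {i} → P i ≡ true → Q i ≡ true

full : VSet n
full _ = true

count : VSet n → ℕ
count P = sum λ i → [ P i ]

count-mono : {P Q : VSet n} → P ⊆ Q → count P ≤ count Q
count-mono {n} P⊆Q = sum-mono-≤ {n} λ _ → []-mono P⊆Q

count-witness : (P : VSet n) → 0 < count P → ∃ λ i → P i ≡ true
count-witness P 0<|P| with sum-positive (λ i → [ P i ]) 0<|P|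
... | i , 0<[Pi] = i , []-positive 0<[Pi]

count-full : (U : VSet n) → count (full {n}) ≡ count U + count (compl U)
count-full {n} U = trans (sum-cong-≗ {n} λ i → sym ([]+[not]≡1 (U i))) (∑-distrib-+ {n} _ _)
  where
  []+[not]≡1 : ∀ x → [ x ] + [ not x ] ≡ 1
  []+[not]≡1 true  = refl
  []+[not]≡1 false = refl

_─_ : VSet n → Fin n → VSet n
(P ─ t) i = P i ∧ not (does (i ≟ t))

─-⊆ : (P : VSet n) (t : Fin n) → (P ─ t) ⊆ P
─-⊆ P t {i} = ∧-conicalˡ (P i) _

─-self : (P : VSet n) (t : Fin n) → (P ─ t) t ≡ false
─-self P t rewrite dec-true (t ≟ t) refl = ∧-zeroʳ (P t)

─-other : (P : VSet n) {t i : Fin n} → i ≢ t → (P ─ t) i ≡ P i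
─-other P {i = i} i≢t rewrite dec-false (i ≟ _) i≢t = ∧-identityʳ (P i)

─-intro : (P : VSet n) {t i : Fin n} → P i ≡ true → i ≢ t → (P ─ t) i ≡ true
─-intro P Pi i≢t = trans (─-other P i≢t) Pi

─-≢ : (P : VSet n) (t : Fin n) {i : Fin n} → (P ─ t) i ≡ true → i ≢ t
─-≢ P t P─ti refl = contradiction (trans (sym P─ti) (─-self P t)) λ ()

count-─ : (P : VSet n) (t : Fin n) → count P ≡ [ P t ] + count (P ─ t)
count-─ {suc n} P t = begin
  count P                            ≡⟨ sum-remove {i = t} [P] ⟩
  [ P t ] + sum {n} (removeAt [P] t) ≡⟨ cong ([ P t ] +_) (sum-cong-≗ λ j →
                                          cong [_] (sym (─-other P (punchInᵢ≢i t j)))) ⟩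
  [ P t ] + rest                     ≡⟨ cong (λ x → [ P t ] + ([ x ] + rest)) (─-self P t) ⟨
  [ P t ] + ([ (P ─ t) t ] + rest)   ≡⟨ cong ([ P t ] +_) (sum-remove {i = t} [P─t]) ⟨
  [ P t ] + count (P ─ t)            ∎
  where
  open ≡-Reasoning
  [P] [P─t] : Fin (suc n) → ℕ
  [P]   i = [ P i ]
  [P─t] i = [ (P ─ t) i ]
  rest : ℕ
  rest = sum {n} (removeAt [P─t] t)

count-─-∈ : (P : VSet n) {t : Fin n} → P t ≡ true → count P ≡ suc (count (P ─ t))
count-─-∈ P {t} Pt = trans (count-─ P t) (cong (λ x → [ x ] + count (P ─ t)) Pt)

─-induction : (Q : VSet n → Set) → (∀ P → (∀ {t} → P t ≡ true → Q (P ─ t)) → Q P) → ∀ P → Q P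
─-induction {n} Q step P = go (count P) P ≤-refl
  where
  go    : ∀ k P → count P ≤ k → Q P
  below : ∀ k P → count P ≤ k → ∀ {t} → P t ≡ true → Q (P ─ t)
  go k P |P|≤k = step P (below k P |P|≤k)
  below zero    P |P|≤0   Pt = contradiction (subst (_≤ 0) (count-─-∈ P Pt) |P|≤0) λ ()
  below (suc k) P |P|≤1+k Pt = go k _ (s≤s⁻¹ (subst (_≤ suc k) (count-─-∈ P Pt) |P|≤1+k))

∃-∉ : (P : VSet n) (xs : List (Fin n)) → length xs < count P → ∃ λ i → P i ≡ true × i ∉ xs
∃-∉ P []       0<|P| with count-witness P 0<|P|
... | i , Pi = i , Pi , λ ()
∃-∉ P (x ∷ xs) |x∷xs|<|P| with ∃-∉ (P ─ x) xs |xs|<|P─x|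
  where
  |xs|<|P─x| : length xs < count (P ─ x)
  |xs|<|P─x| = s<s⁻¹ (begin-strict
    suc (length xs)         <⟨ |x∷xs|<|P| ⟩
    count P                 ≡⟨ count-─ P x ⟩
    [ P x ] + count (P ─ x) ≤⟨ +-monoˡ-≤ _ ([]≤1 (P x)) ⟩
    suc (count (P ─ x))     ∎)
    where open ≤-Reasoning
... | i , P─xi , i∉xs = i , ─-⊆ P x P─xi , λ where
  (here refl)  → ─-≢ P x P─xi refl
  (there i∈xs) → i∉xs i∈xs

-- Subgraphs of large minimum degree

AdjMatrix : ℕ → Set
AdjMatrix n = Fin n → Fin n → Bool

deg : AdjMatrix n → VSet n → Fin n → ℕ
deg H T i = count λ j → H i j ∧ T j

arcs : AdjMatrix n → VSet n → ℕ
arcs H T = sum² λ i j → [ H i j ∧ T i ∧ T j ]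

arcs-witness : (H : AdjMatrix n) (T : VSet n) → 0 < arcs H T → ∃ λ i → T i ≡ true
arcs-witness {n} H T 0<arcs with sum-positive {n} _ 0<arcs
... | i , 0<Σ with sum-positive {n} _ 0<Σ
...   | j , 0<arc = i , ∧-conicalˡ (T i) _ (∧-conicalʳ (H i j) _ ([]-positive 0<arc))

module _ (H : AdjMatrix n) (H-sym : ∀ i j → H i j ≡ H j i) (T : VSet n) (t : Fin n) where

  private
    row col : Fin n → Fin n → ℕ
    row i j = [ does (i ≟ t) ∧ (H i j ∧ T j) ]
    col i j = [ does (j ≟ t) ∧ (H t i ∧ T i) ]

    -- An arc of T avoids t, or leaves t (counted in row), or enters t (counted in col).
    arc≤ : ∀ i j → [ H i j ∧ T i ∧ T j ] ≤ [ H i j ∧ (T ─ t) i ∧ (T ─ t) j ] + row i j + col i j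
    arc≤ i j with i ≟ t | j ≟ t
    ... | yes refl | j≟t = ≤-trans
          ([]-mono {H i j ∧ T i ∧ T j} {H i j ∧ T j} λ h →
            ∧-intro (∧-conicalˡ _ _ h) (∧-conicalʳ (T i) _ (∧-conicalʳ (H i j) _ h)))
          (≤-trans (m≤n+m [ H i j ∧ T j ] _) (m≤m+n _ [ does j≟t ∧ (H i i ∧ T i) ]))
    ... | no _ | yes refl = ≤-trans
          ([]-mono {H i j ∧ T i ∧ T j} {H j i ∧ T i} λ h →
            ∧-intro (trans (H-sym j i) (∧-conicalˡ _ _ h)) (∧-conicalˡ _ (T j) (∧-conicalʳ (H i j) _ h)))
          (m≤n+m _ _)
    ... | no _ | no _ rewrite ∧-identityʳ (T i) | ∧-identityʳ (T j) = ≤-trans (m≤m+n _ _) (m≤m+n _ _)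

    row-sum : sum² row ≡ deg H T t
    row-sum = trans (sum-supported-at t row-off) row-on
      where
      row-off : ∀ i → i ≢ t → sum (row i) ≡ 0
      row-off i i≢t rewrite dec-false (i ≟ t) i≢t = sum-replicate-zero n
      row-on : sum (row t) ≡ deg H T t
      row-on rewrite dec-true (t ≟ t) refl = refl

    col-sum : sum² col ≡ deg H T t
    col-sum = sum-cong-≗ λ i → trans (sum-supported-at t (col-off i)) (col-on i)
      where
      col-off : ∀ i j → j ≢ t → col i j ≡ 0
      col-off i j j≢t rewrite dec-false (j ≟ t) j≢t = refl
      col-on : ∀ i → col i t ≡ [ H t i ∧ T i ]
      col-on i rewrite dec-true (t ≟ t) refl = refl

  arcs-─ : arcs H T ≤ arcs H (T ─ t) + deg H T t + deg H T t
  arcs-─ = begin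
    arcs H T                                     ≤⟨ sum²-mono-≤ arc≤ ⟩
    sum² (λ i j → arc′ i j + row i j + col i j)  ≡⟨ sum²-distrib-+ (λ i j → arc′ i j + row i j) col ⟩
    sum² (λ i j → arc′ i j + row i j) + sum² col ≡⟨ cong (_+ sum² col) (sum²-distrib-+ arc′ row) ⟩
    arcs H (T ─ t) + sum² row + sum² col         ≡⟨ cong₂ (λ r c → arcs H (T ─ t) + r + c) row-sum col-sum ⟩
    arcs H (T ─ t) + deg H T t + deg H T t       ∎
    where
    open ≤-Reasoning
    arc′ : Fin n → Fin n → ℕ
    arc′ i j = [ H i j ∧ (T ─ t) i ∧ (T ─ t) j ]

record Core (H : AdjMatrix n) (c : ℕ) (T : VSet n) : Set where
  field
    S      : VSet n
    S⊆T    : S ⊆ T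
    root   : Fin n
    root∈S : S root ≡ true
    deg>c  : ∀ {i} → S i ≡ true → c < deg H S i

dense⇒core : (H : AdjMatrix n) → (∀ i j → H i j ≡ H j i) → (c : ℕ) (T : VSet n) →
  2 * c * count T < arcs H T → Core H c T
dense⇒core H H-sym c = ─-induction _ step
  where
  step : ∀ T → (∀ {t} → T t ≡ true → 2 * c * count (T ─ t) < arcs H (T ─ t) → Core H c (T ─ t)) →
    2 * c * count T < arcs H T → Core H c T
  step T IH dense with any? (λ i → (T i Bool.≟ true) ×-dec (deg H T i ≤? c))
  ... | no ¬low = record
    { S = T ; S⊆T = id ; root = proj₁ T≠∅ ; root∈S = proj₂ T≠∅
    ; deg>c = λ Ti → ≰⇒> λ d≤c → ¬low (_ , Ti , d≤c) }
    where T≠∅ = arcs-witness H T (≤-<-trans z≤n dense)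
  ... | yes (t , Tt , low) = weaken (IH Tt dense′)
    where
    open ≤-Reasoning
    dense′ : 2 * c * count (T ─ t) < arcs H (T ─ t)
    dense′ = +-cancelʳ-< _ _ _ (begin-strict
      2 * c * count (T ─ t) + 2 * c            ≡⟨ +-comm _ (2 * c) ⟩
      2 * c + 2 * c * count (T ─ t)            ≡⟨ *-suc (2 * c) _ ⟨
      2 * c * suc (count (T ─ t))              ≡⟨ cong (2 * c *_) (count-─-∈ T Tt) ⟨
      2 * c * count T                          <⟨ dense ⟩
      arcs H T                                 ≤⟨ arcs-─ H H-sym T t ⟩
      arcs H (T ─ t) + deg H T t + deg H T t   ≡⟨ +-assoc (arcs H (T ─ t)) _ _ ⟩
      arcs H (T ─ t) + (deg H T t + deg H T t) ≤⟨ +-monoʳ-≤ (arcs H (T ─ t)) (+-mono-≤ low low) ⟩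
      arcs H (T ─ t) + (c + c)                 ≡⟨ cong (λ x → arcs H (T ─ t) + (c + x)) (+-identityʳ c) ⟨
      arcs H (T ─ t) + 2 * c                   ∎)
    weaken : Core H c (T ─ t) → Core H c T
    weaken core = record { Core core ; S⊆T = ─-⊆ T t ∘ Core.S⊆T core }

crossing : Graph n → VSet n → AdjMatrix n
crossing G U i j = adj G i j ∧ (U i xor U j)

crossing-sym : (G : Graph n) (U : VSet n) → ∀ i j → crossing G U i j ≡ crossing G U j i
crossing-sym G U i j = cong₂ _∧_ (symm G i j) (xor-comm (U i) (U j))

2e≤arcs : (G : Graph n) (U : VSet n) → 2 * e G U ≤ arcs (adj G) U
2e≤arcs {n} G U = begin
  2 * e G U        ≡⟨ cong (2 *_) (Σ-Fin²≡sum² forward) ⟩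
  2 * sum² forward ≤⟨ sum²-double forward _ pair ⟩
  arcs (adj G) U   ∎
  where
  open ≤-Reasoning
  edge : Fin n → Fin n → Bool
  edge i j = adj G i j ∧ U i ∧ U j
  forward : Fin n → Fin n → ℕ
  forward i j = [ (toℕ i <ᵇ toℕ j) ∧ edge i j ]
  edge-sym : ∀ i j → edge j i ≡ edge i j
  edge-sym i j = cong₂ _∧_ (symm G j i) (∧-comm (U j) (U i))
  one-way : ∀ b b′ x → (b ≡ true → b′ ≡ false) → [ b ∧ x ] + [ b′ ∧ x ] ≤ [ x ]
  one-way true  b′ x b⇒¬b′ rewrite b⇒¬b′ refl = ≤-reflexive (+-identityʳ [ x ])
  one-way false b′ x _ = []-mono (∧-conicalʳ b′ x)
  <ᵇ-asym : ∀ a b → (a <ᵇ b) ≡ true → (b <ᵇ a) ≡ false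
  <ᵇ-asym a b a<b with b <ᵇ a in b<a
  ... | false = refl
  ... | true  = contradiction (<ᵇ⇒< b a (subst T (sym b<a) _)) (<-asym (<ᵇ⇒< a b (subst T (sym a<b) _)))
  pair : ∀ i j → forward i j + forward j i ≤ [ edge i j ]
  pair i j rewrite edge-sym i j = one-way _ _ (edge i j) (<ᵇ-asym (toℕ i) (toℕ j))

2e₂≤arcs : (G : Graph n) (U : VSet n) → 2 * e₂ G U (compl U) ≤ arcs (crossing G U) full
2e₂≤arcs {n} G U = begin
  2 * e₂ G U (compl U)     ≡⟨ cong (2 *_) (Σ-Fin²≡sum² outward) ⟩
  2 * sum² outward         ≤⟨ sum²-double outward _ pair ⟩
  arcs (crossing G U) full ∎
  where
  open ≤-Reasoning
  outward : Fin n → Fin n → ℕ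
  outward i j = [ adj G i j ∧ U i ∧ not (U j) ]
  one-side : ∀ a x y → [ a ∧ x ∧ not y ] + [ a ∧ y ∧ not x ] ≤ [ (a ∧ (x xor y)) ∧ true ]
  one-side false _     _     = z≤n
  one-side true  true  true  = z≤n
  one-side true  true  false = ≤-refl
  one-side true  false true  = ≤-refl
  one-side true  false false = z≤n
  pair : ∀ i j → outward i j + outward j i ≤ [ crossing G U i j ∧ true ∧ true ]
  pair i j rewrite symm G j i = one-side (adj G i j) (U i) (U j)

module _ (G : Graph n) (U : VSet n) (c : ℕ) where

  dense-inside : c * count U < e G U → 2 * c * count U < arcs (adj G) U
  dense-inside c|U|<e = begin-strict
    2 * c * count U   ≡⟨ *-assoc 2 c (count U) ⟩
    2 * (c * count U) <⟨ *-monoʳ-< 2 c|U|<e ⟩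
    2 * e G U         ≤⟨ 2e≤arcs G U ⟩
    arcs (adj G) U    ∎
    where open ≤-Reasoning

  dense-across : 2 * e G U + e₂ G U (compl U) > 3 * c * card U + c * card (compl U) →
    e G U ≤ c * count U → 2 * c * count (full {n}) < arcs (crossing G U) full
  dense-across dense e≤c|U| = begin-strict
    2 * c * count (full {n}) ≡⟨ cong (2 * c *_) (count-full U) ⟩
    2 * c * (u + w)          ≡⟨ distrib c u w ⟩
    2 * (c * u + c * w)      <⟨ *-monoʳ-< 2 (+-cancelˡ-< (2 * (c * u)) _ _ (begin-strict
      2 * (c * u) + (c * u + c * w)        ≡⟨ regroup c u w ⟩
      3 * c * u + c * w                    ≡⟨ cong₂ (λ u w → 3 * c * u + c * w) (Σ-Fin≡sum [U]) (Σ-Fin≡sum [W]) ⟨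
      3 * c * card U + c * card (compl U)  <⟨ dense ⟩
      2 * e G U + e₂ G U (compl U)         ≤⟨ +-monoˡ-≤ _ (*-monoʳ-≤ 2 e≤c|U|) ⟩
      2 * (c * u) + e₂ G U (compl U)       ∎)) ⟩
    2 * e₂ G U (compl U)     ≤⟨ 2e₂≤arcs G U ⟩
    arcs (crossing G U) full ∎
    where
    open ≤-Reasoning
    [U] [W] : Fin n → ℕ
    [U] i = [ U i ]
    [W] i = [ compl U i ]
    u w : ℕ
    u = count U
    w = count (compl U)
    distrib : ∀ c u w → 2 * c * (u + w) ≡ 2 * (c * u + c * w)
    distrib = solve-∀
    regroup : ∀ c u w → 2 * (c * u) + (c * u + c * w) ≡ 3 * c * u + c * w
    regroup = solve-∀

-- Leaf orders of forests

InjectiveBelow : {A : Set} → (ℕ → A) → ℕ → Set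
InjectiveBelow a N = ∀ {i j} → i < N → j < N → a i ≡ a j → i ≡ j

record FirstRepetition {A : Set} (a : ℕ → A) : Set where
  field
    i j       : ℕ
    i<j       : i < j
    aᵢ≡aⱼ     : a i ≡ a j
    injective : InjectiveBelow a j

injectiveBelow⊎firstRepetition : {A : Set} → DecidableEquality A → (a : ℕ → A) →
  ∀ N → InjectiveBelow a N ⊎ FirstRepetition a
injectiveBelow⊎firstRepetition _≟ᴬ_ a zero = inj₁ λ ()
injectiveBelow⊎firstRepetition _≟ᴬ_ a (suc N) with injectiveBelow⊎firstRepetition _≟ᴬ_ a N
... | inj₂ rep = inj₂ rep
... | inj₁ inj with any? (λ (i : Fin N) → a (toℕ i) ≟ᴬ a N)
...   | yes (i , aᵢ≡a_N) = inj₂ record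
  { i = toℕ i ; j = N ; i<j = toℕ<n i ; aᵢ≡aⱼ = aᵢ≡a_N ; injective = inj }
...   | no a_N-new = inj₁ inj′
  where
  new : ∀ {i} → i < N → a i ≢ a N
  new i<N aᵢ≡a_N = a_N-new (fromℕ< i<N , trans (cong a (toℕ-fromℕ< i<N)) aᵢ≡a_N)
  inj′ : InjectiveBelow a (suc N)
  inj′ i<1+N j<1+N aᵢ≡aⱼ with m<1+n⇒m<n∨m≡n i<1+N | m<1+n⇒m<n∨m≡n j<1+N
  ... | inj₁ i<N  | inj₁ j<N  = inj i<N j<N aᵢ≡aⱼ
  ... | inj₁ i<N  | inj₂ refl = contradiction aᵢ≡aⱼ (new i<N)
  ... | inj₂ refl | inj₁ j<N  = contradiction (sym aᵢ≡aⱼ) (new j<N)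
  ... | inj₂ refl | inj₂ refl = refl

firstRepetition : ∀ {m} (a : ℕ → Fin m) → FirstRepetition a
firstRepetition {m} a with injectiveBelow⊎firstRepetition _≟_ a (suc m)
... | inj₂ rep = rep
... | inj₁ inj with pigeonhole (n<1+n m) (a ∘ toℕ)
...   | i , j , i<j , aᵢ≡aⱼ = contradiction (inj (toℕ<n i) (toℕ<n j) aᵢ≡aⱼ) (<⇒≢ i<j)

module _ {m : ℕ} (F : Graph m) where

  AtMostOneNeighbourIn : Fin m → (Fin m → Set) → Set
  AtMostOneNeighbourIn x S = ∀ {y z} → S y → S z → Adj F x y → Adj F x z → y ≡ z

  -- Read right to left, each vertex joins the forest built so far as a leaf or an isolated vertex.
  data LeafOrder : List (Fin m) → Set where
    []   : LeafOrder []
    cons : ∀ {x L} → x ∉ L → AtMostOneNeighbourIn x (_∈ L) → LeafOrder L → LeafOrder (x ∷ L)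

  NeighbourBesides : VSet m → Fin m → Fin m → Set
  NeighbourBesides R x p = ∃ λ y → R y ≡ true × Adj F x y × y ≢ p

  neighbourBesides? : (R : VSet m) → ∀ x p → Dec (NeighbourBesides R x p)
  neighbourBesides? R x p = any? λ y → (R y Bool.≟ true) ×-dec (adj F x y Bool.≟ true) ×-dec ¬? (y ≟ p)

  Branching : VSet m → Fin m → Set
  Branching R x = ∀ p → NeighbourBesides R x p

  record Arc (R : VSet m) : Set where
    constructor arc
    field
      prev cur : Fin m
      cur∈R    : R cur ≡ true
      edge     : Adj F prev cur

module _ {m : ℕ} (F : Graph m) (v : Fin m) where

  record NonBacktrackingWalk : Set where
    field
      a                : ℕ → Fin m
      avoids           : ∀ k → a k ≢ v
      adjacent         : ∀ k → Adj F (a k) (a (suc k))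
      non-backtracking : ∀ k → a (suc (suc k)) ≢ a k

  module _ (walk : NonBacktrackingWalk) where
    open NonBacktrackingWalk walk

    private
      cycle-at : ∀ {i j} → i < j → a i ≡ a j → InjectiveBelow a j → CycleAvoiding F v
      cycle-at {i} i<j aᵢ≡aⱼ inj with m≤n⇒∃[o]m+o≡n i<j
      ... | zero , refl = contradiction (subst (Adj F (a i)) (sym aᵢ≡aᵢ₊₁) (adjacent i)) (irrefl-Adj F)
        where aᵢ≡aᵢ₊₁ = trans aᵢ≡aⱼ (cong a (+-identityʳ (suc i)))
      ... | suc zero , refl = contradiction (trans (cong (a ∘ suc) (+-comm 1 i)) (sym aᵢ≡aⱼ)) (non-backtracking i)
      ... | suc (suc l) , refl =
        l , cycle , cycle-injective , (λ t → avoids (i + toℕ t)) , cycle-adjacent , cycle-closes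
        where
        cycle : Fin (3 + l) → Fin m
        cycle t = a (i + toℕ t)
        in-window : ∀ t → i + toℕ t < suc i + suc (suc l)
        in-window t = subst (i + toℕ t <_) (+-suc i (2 + l)) (+-monoʳ-< i (toℕ<n t))
        cycle-injective : ∀ s t → cycle s ≡ cycle t → s ≡ t
        cycle-injective s t eq = toℕ-injective (+-cancelˡ-≡ i _ _ (inj (in-window s) (in-window t) eq))
        cycle-adjacent : ∀ (t : Fin (2 + l)) → Adj F (cycle (inject₁ t)) (cycle (suc t))
        cycle-adjacent t rewrite toℕ-inject₁ t | +-suc i (toℕ t) = adjacent (i + toℕ t)
        cycle-closes : Adj F (cycle (fromℕ (2 + l))) (cycle zero)
        cycle-closes rewrite toℕ-fromℕ (2 + l) | +-identityʳ i =
          subst (Adj F (a (i + (2 + l)))) (sym aᵢ≡aⱼ) (adjacent (i + (2 + l)))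

    walk⇒cycle : CycleAvoiding F v
    walk⇒cycle = let open FirstRepetition (firstRepetition a) in cycle-at i<j aᵢ≡aⱼ injective

  branching⇒walk : (R : VSet m) → (∀ {x} → R x ≡ true → x ≢ v) →
    (∀ {x} → R x ≡ true → Branching F R x) → ∀ {x} → R x ≡ true → NonBacktrackingWalk
  branching⇒walk R R-avoids branching {x} x∈R = record
    { a = a ; avoids = avoids ; adjacent = Arc.edge ∘ state ; non-backtracking = non-backtracking }
    where
    next : Arc F R → Arc F R
    next (arc p c c∈R _) with branching c∈R p
    ... | y , y∈R , c~y , _ = arc c y y∈R c~y
    start : Arc F R
    start with branching x∈R x
    ... | y , y∈R , x~y , _ = arc x y y∈R x~y
    state : ℕ → Arc F R
    state = fold start next
    a : ℕ → Fin m
    a = Arc.prev ∘ state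
    avoids : ∀ k → a k ≢ v
    avoids zero    = R-avoids x∈R
    avoids (suc k) = R-avoids (Arc.cur∈R (state k))
    non-backtracking : ∀ k → a (suc (suc k)) ≢ a k
    non-backtracking k = proj₂ (proj₂ (proj₂ (branching (Arc.cur∈R (state k)) (Arc.prev (state k)))))

  ∃-leaf : DeleteIsForest F v → (R : VSet m) → (∀ {x} → R x ≡ true → x ≢ v) → ∀ {x₀} → R x₀ ≡ true →
    ∃ λ x → R x ≡ true × AtMostOneNeighbourIn F x (λ y → R y ≡ true)
  ∃-leaf forest R R-avoids {x₀} x₀∈R
    with any? (λ x → (R x Bool.≟ true) ×-dec ¬? (all? (neighbourBesides? F R x)))
  ... | no ¬leaf = contradiction (walk⇒cycle (branching⇒walk R R-avoids branching x₀∈R)) forest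
    where
    branching : ∀ {x} → R x ≡ true → Branching F R x
    branching {x} x∈R = decidable-stable (all? (neighbourBesides? F R x)) λ ¬b → ¬leaf (x , x∈R , ¬b)
  ... | yes (x , x∈R , ¬branching) with ¬∀⟶∃¬ m _ (neighbourBesides? F R x) ¬branching
  ...   | p , none-besides-p = x , x∈R , λ y∈R z∈R x~y x~z → trans (is-p y∈R x~y) (sym (is-p z∈R x~z))
    where
    is-p : ∀ {y} → R y ≡ true → Adj F x y → y ≡ p
    is-p {y} y∈R x~y = decidable-stable (y ≟ p) λ y≢p → none-besides-p (y , y∈R , x~y , y≢p)

  record LeafOrdering (R : VSet m) : Set where
    field
      list     : List (Fin m)
      ordered  : LeafOrder F list
      sound    : ∀ {x} → x ∈ list → R x ≡ true
      complete : ∀ {x} → R x ≡ true → x ∈ list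

  leafOrdering : DeleteIsForest F v → (R : VSet m) → (∀ {x} → R x ≡ true → x ≢ v) → LeafOrdering R
  leafOrdering forest = ─-induction _ step
    where
    step : ∀ R → (∀ {x} → R x ≡ true → (∀ {y} → (R ─ x) y ≡ true → y ≢ v) → LeafOrdering (R ─ x)) →
      (∀ {x} → R x ≡ true → x ≢ v) → LeafOrdering R
    step R IH R-avoids with any? (λ x → R x Bool.≟ true)
    ... | no R≡∅ = record
      { list = [] ; ordered = [] ; sound = λ () ; complete = λ x∈R → contradiction (_ , x∈R) R≡∅ }
    ... | yes (x₀ , x₀∈R) with ∃-leaf forest R R-avoids x₀∈R
    ...   | x , x∈R , leaf = record
      { list     = x ∷ list
      ; ordered  = cons (λ x∈L → ─-≢ R x (sound x∈L) refl)
                        (λ y∈L z∈L → leaf (─-⊆ R x (sound y∈L)) (─-⊆ R x (sound z∈L))) ordered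
      ; sound    = λ { (here refl) → x∈R ; (there y∈L) → ─-⊆ R x (sound y∈L) }
      ; complete = complete′ }
      where
      open LeafOrdering (IH x∈R λ y∈R─x → R-avoids (─-⊆ R x y∈R─x))
      complete′ : ∀ {y} → R y ≡ true → y ∈ x ∷ list
      complete′ {y} y∈R with y ≟ x
      ... | yes refl = here refl
      ... | no y≢x   = there (complete (─-intro R y∈R y≢x))

-- Greedy embedding of a leaf order

module _ {m : ℕ} (F : Graph m) (G : Graph n) (A : Fin m → VSet n) where

  record EmbeddingOn (L : List (Fin m)) (φ : Fin m → Fin n) : Set where
    field
      candidate : ∀ {x} → x ∈ L → A x (φ x) ≡ true
      injective : ∀ {x y} → x ∈ L → y ∈ L → φ x ≡ φ y → x ≡ y
      adjacent  : ∀ {x y} → x ∈ L → y ∈ L → Adj F x y → Adj G (φ x) (φ y)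

  extend : ∀ {L φ x t} → EmbeddingOn L φ → x ∉ L → A x t ≡ true → t ∉ map φ L →
    (∀ {y} → y ∈ L → Adj F x y → Adj G t (φ y)) → EmbeddingOn (x ∷ L) (updateAt φ x (const t))
  extend {L} {φ} {x} {t} emb x∉L Axt t∉φL x~y⇒t~φy = record
    { candidate = candidate′ ; injective = injective′ ; adjacent = adjacent′ }
    where
    open EmbeddingOn emb
    at-x : updateAt φ x (const t) x ≡ t
    at-x = updateAt-updates x φ
    on-L : ∀ {y} → y ∈ L → updateAt φ x (const t) y ≡ φ y
    on-L y∈L = updateAt-minimal _ x φ λ { refl → x∉L y∈L }
    t≢φ : ∀ {y} → y ∈ L → t ≢ φ y
    t≢φ y∈L t≡φy = t∉φL (subst (_∈ map φ L) (sym t≡φy) (∈-map⁺ φ y∈L))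

    candidate′ : ∀ {y} → y ∈ x ∷ L → A y (updateAt φ x (const t) y) ≡ true
    candidate′ (here refl)  rewrite at-x    = Axt
    candidate′ (there y∈L) rewrite on-L y∈L = candidate y∈L

    injective′ : ∀ {y z} → y ∈ x ∷ L → z ∈ x ∷ L →
      updateAt φ x (const t) y ≡ updateAt φ x (const t) z → y ≡ z
    injective′ (here refl)  (here refl)  _  = refl
    injective′ (here refl)  (there z∈L) eq rewrite at-x | on-L z∈L = contradiction eq (t≢φ z∈L)
    injective′ (there y∈L) (here refl)  eq rewrite at-x | on-L y∈L = contradiction (sym eq) (t≢φ y∈L)
    injective′ (there y∈L) (there z∈L) eq rewrite on-L y∈L | on-L z∈L = injective y∈L z∈L eq

    adjacent′ : ∀ {y z} → y ∈ x ∷ L → z ∈ x ∷ L → Adj F y z →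
      Adj G (updateAt φ x (const t) y) (updateAt φ x (const t) z)
    adjacent′ (here refl)  (here refl)  x~x = contradiction x~x (irrefl-Adj F)
    adjacent′ (here refl)  (there z∈L) x~z rewrite at-x | on-L z∈L = x~y⇒t~φy z∈L x~z
    adjacent′ (there y∈L) (here refl)  y~x rewrite at-x | on-L y∈L = sym-Adj G (x~y⇒t~φy y∈L (sym-Adj F y~x))
    adjacent′ (there y∈L) (there z∈L) y~z rewrite on-L y∈L | on-L z∈L = adjacent y∈L z∈L y~z

  module _ (k : ℕ) (d : Fin n)
    (enough      : ∀ x → k < count (A x))
    (enough-near : ∀ {x y} → Adj F x y → ∀ {s} → A y s ≡ true → k < count (λ t → adj G s t ∧ A x t))
    where

    greedy : ∀ {L} → LeafOrder F L → length L ≤ k → Σ (Fin m → Fin n) (EmbeddingOn L)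
    greedy [] _ = const d , record { candidate = λ () ; injective = λ () ; adjacent = λ () }
    greedy {x ∷ L} (cons x∉L leaf order) |L|<k with greedy order (<⇒≤ |L|<k)
    ... | φ , emb with Any.any? (λ y → adj F x y Bool.≟ true) L
    ...   | yes x~L with find x~L
    ...     | y₀ , y₀∈L , x~y₀ with ∃-∉ (λ t → adj G (φ y₀) t ∧ A x t) (map φ L)
                                       (|φL|< (enough-near x~y₀ (EmbeddingOn.candidate emb y₀∈L)))
      where
      |φL|< : ∀ {N} → k < N → length (map φ L) < N
      |φL|< k<N = subst (_< _) (sym (length-map φ L)) (<-trans |L|<k k<N)
    ...       | t , φy₀~t∧Axt , t∉φL = _ , extend emb x∉L (∧-conicalʳ _ _ φy₀~t∧Axt) t∉φL t~φy
      where
      t~φy : ∀ {y} → y ∈ L → Adj F x y → Adj G t (φ y)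
      t~φy y∈L x~y rewrite leaf y∈L y₀∈L x~y x~y₀ = sym-Adj G (∧-conicalˡ _ _ φy₀~t∧Axt)
    greedy {x ∷ L} (cons x∉L leaf order) |L|<k | φ , emb | no x≁L
      with ∃-∉ (A x) (map φ L) (subst (_< _) (sym (length-map φ L)) (<-trans |L|<k (enough x)))
    ... | t , Axt , t∉φL = _ , extend emb x∉L Axt t∉φL λ y∈L x~y → contradiction (lose y∈L x~y) x≁L

-- Copies of F − v

module _ {m : ℕ} (F : Graph m) (v : Fin m) (forest : DeleteIsForest F v) where

  private
    open LeafOrdering (leafOrdering F v forest (full ─ v) (─-≢ full v))

  vertexCount : ℕ
  vertexCount = length list

  module _ (G : Graph n) (U : VSet n) where

    copy-from-candidates : (A : Fin m → VSet n) → Fin n →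
      (∀ x → vertexCount < count (A x)) →
      (∀ {x y} → Adj F x y → ∀ {s} → A y s ≡ true → vertexCount < count (λ t → adj G s t ∧ A x t)) →
      (∀ {x t} → Adj F v x → A x t ≡ true → U t ≡ true) →
      CopyMinusWithNbhdIn F v G U
    copy-from-candidates A d enough enough-near A⇒U
      with greedy F G A vertexCount d enough enough-near ordered ≤-refl
    ... | φ , emb = (λ x _ → φ x)
                  , (λ _ _ x≢v y≢v → injective (listed x≢v) (listed y≢v))
                  , (λ _ _ x≢v y≢v → adjacent (listed x≢v) (listed y≢v))
                  , λ _ x≢v v~x → A⇒U v~x (candidate (listed x≢v))
      where
      open EmbeddingOn emb
      listed : ∀ {x} → x ≢ v → x ∈ list
      listed x≢v = complete (─-intro full refl x≢v)

    copy-inside : Core (adj G) vertexCount U → CopyMinusWithNbhdIn F v G U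
    copy-inside core = copy-from-candidates (λ _ → S) root
      (λ _ → <-≤-trans (deg>c root∈S) (count-mono λ {t} → ∧-conicalʳ (adj G root t) (S t)))
      (λ _ → deg>c) (λ _ → S⊆T)
      where open Core core

    copy-across : Bipartite F → Core (crossing G U) vertexCount full → CopyMinusWithNbhdIn F v G U
    copy-across (col , proper) core = copy-from-candidates A root enough enough-near A⇒U
      where
      open Core core

      -- x goes to U exactly when its colour differs from that of v.
      side : Fin m → Bool
      side x = col x xor col v

      side-adjacent : ∀ {x y} → Adj F x y → side y ≡ not (side x)
      side-adjacent {x} {y} x~y = trans (cong (_xor col v) (¬-not (proper y x (sym-Adj F x~y))))
                                        (sym (not-distribˡ-xor (col x) (col v)))

      side-of-neighbour-of-v : ∀ {x} → Adj F v x → side x ≡ true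
      side-of-neighbour-of-v v~x = trans (side-adjacent v~x) (cong not (xor-same (col v)))

      OnSide : Bool → VSet n
      OnSide b t = S t ∧ does (U t Bool.≟ b)

      A : Fin m → VSet n
      A x = OnSide (side x)

      on-side : ∀ {b t} → OnSide b t ≡ true → U t ≡ b
      on-side {b} {t} h with U t Bool.≟ b
      ... | yes Ut≡b = Ut≡b
      ... | no _     = contradiction (∧-conicalʳ (S t) false h) λ ()

      across : ∀ {s t} → crossing G U s t ≡ true → U t ≡ not (U s)
      across {s} {t} h = xor-true (∧-conicalʳ (adj G s t) _ h)
        where
        xor-true : ∀ {x y} → x xor y ≡ true → y ≡ not x
        xor-true {true}  {false} _ = refl
        xor-true {false} {true}  _ = refl

      neighbours-on-side : ∀ {s} b → S s ≡ true → U s ≡ not b →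
        vertexCount < count (λ t → adj G s t ∧ OnSide b t)
      neighbours-on-side {s} b Ss Us≡¬b =
        <-≤-trans (deg>c Ss) (count-mono {P = λ t → crossing G U s t ∧ S t} on-b)
        where
        on-b : ∀ {t} → crossing G U s t ∧ S t ≡ true → adj G s t ∧ OnSide b t ≡ true
        on-b {t} h = ∧-intro (∧-conicalˡ (adj G s t) _ s~t)
                             (∧-intro (∧-conicalʳ _ (S t) h) (dec-true (U t Bool.≟ b) Ut≡b))
          where
          s~t  = ∧-conicalˡ _ (S t) h
          Ut≡b = trans (across s~t) (trans (cong not Us≡¬b) (not-involutive b))

      each-side : ∀ b → ∃ λ s → S s ≡ true × U s ≡ not b
      each-side b with U root Bool.≟ not b
      ... | yes Uroot≡¬b = root , root∈S , Uroot≡¬b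
      ... | no  Uroot≢¬b with count-witness _ (≤-<-trans z≤n (deg>c root∈S))
      ...   | t , root~t∧St = t , ∧-conicalʳ _ (S t) root~t∧St
                                , trans (across (∧-conicalˡ _ (S t) root~t∧St))
                                        (cong not (trans (¬-not Uroot≢¬b) (not-involutive b)))

      enough : ∀ x → vertexCount < count (A x)
      enough x with each-side (side x)
      ... | s , Ss , Us≡ = <-≤-trans (neighbours-on-side (side x) Ss Us≡)
                                     (count-mono λ {t} → ∧-conicalʳ (adj G s t) _)

      enough-near : ∀ {x y} → Adj F x y → ∀ {s} → A y s ≡ true →
        vertexCount < count (λ t → adj G s t ∧ A x t)
      enough-near x~y {s} Ays =
        neighbours-on-side _ (∧-conicalˡ (S s) _ Ays) (trans (on-side Ays) (side-adjacent x~y))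

      A⇒U : ∀ {x t} → Adj F v x → A x t ≡ true → U t ≡ true
      A⇒U v~x Axt = trans (on-side Axt) (side-of-neighbour-of-v v~x)

lemma3p1 : ∀ {m} (F : Graph m) (v : Fin m) → Bipartite F → DeleteIsForest F v →
    Σ ℕ λ c → ∀ {n} (G : Graph n) (U : VSet n) →
      2 * e G U + e₂ G U (compl U) > 3 * c * card U + c * card (compl U) →
      CopyMinusWithNbhdIn F v G U
lemma3p1 F v bip forest = c , copy
  where
  c : ℕ
  c = vertexCount F v forest
  copy : ∀ {n} (G : Graph n) (U : VSet n) →
    2 * e G U + e₂ G U (compl U) > 3 * c * card U + c * card (compl U) → CopyMinusWithNbhdIn F v G U
  copy G U dense with c * count U <? e G U
  ... | yes c|U|<e = copy-inside F v forest G U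
                       (dense⇒core (adj G) (symm G) c U (dense-inside G U c c|U|<e))
  ... | no  c|U|≮e = copy-across F v forest G U bip
                       (dense⇒core (crossing G U) (crossing-sym G U) c full
                         (dense-across G U c dense (≮⇒≥ c|U|≮e)))
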